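{- Let $a$ be a rational number with $v_3(a)=0$, and let $\mathcal{R}_a=\{(0,1/2),(0,-1/2),(a,1/2),(a,-1/2)\}$. Suppose $(x,z/2)\in\mathbb{R}^2$ has rational Euclidean distance to each of the four points of $\mathcal{R}_a$ (so $x,z\in\mathbb{Q}$). Then $v_3(x)<0$ or $v_3(z)<0$, and moreover $v_3(x)\neq v_3(z)$.
   Context: For a prime $p$ and a nonzero rational $t=p^k r/s$ with $r,s$ integers coprime to $p$, $v_p(t)=k$; and $v_p(0)=\infty$. -}

module Defs where

open import Data.Nat using (ℕ; zero; suc)
open import Data.Integer as ℤ using (ℤ; +_; -[1+_])
open import Data.Integer.Divisibility using (_∣_)
open import Data.Rational using (ℚ; _/_; 0ℚ; _*_)
open import Data.Product using (Σ; _×_)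
open import Relation.Nullary using (¬_)
open import Relation.Binary.PropositionalEquality using (_≡_; _≢_)

ι : ℤ → ℚ
ι z = z / 1

data ℤ∞ : Set where
  fin : ℤ → ℤ∞
  ∞   : ℤ∞

posPart : ℤ → ℕ
posPart (+ m)      = m
posPart -[1+ m ]   = 0

negPart : ℤ → ℕ
negPart (+ m)      = 0
negPart -[1+ m ]   = suc m

-- t = p^k r / s with integers r, s coprime to p (i.e. p ∤ r, p ∤ s),
-- written with denominators cleared: t * s * p^(negPart k) = p^(posPart k) * r.
-- (p ∤ s forces s ≠ 0.)
IsPowTimesUnit : ℕ → ℚ → ℤ → Set
IsPowTimesUnit p t k =
  Σ ℤ λ r → Σ ℤ λ s →
    ¬ ((+ p) ∣ r) × ¬ ((+ p) ∣ s) ×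
    (t * ι s * ι ((+ p) ℤ.^ negPart k) ≡ ι ((+ p) ℤ.^ posPart k ℤ.* r))

data Val (p : ℕ) : ℚ → ℤ∞ → Set where
  val-zero : Val p 0ℚ ∞
  val-fin  : ∀ {t k} → t ≢ 0ℚ → IsPowTimesUnit p t k → Val p t (fin k)

IsRationalSqrt : ℚ → ℚ → Set
IsRationalSqrt d D = (0ℚ Data.Rational.≤ d) × (d * d ≡ D)

RationalDist : ℚ → ℚ → ℚ → ℚ → Set
RationalDist x₁ y₁ x₂ y₂ =
  Σ ℚ λ d → IsRationalSqrt d ((x₁ Data.Rational.- x₂) * (x₁ Data.Rational.- x₂)
                              Data.Rational.+ (y₁ Data.Rational.- y₂) * (y₁ Data.Rational.- y₂))

-- Scaling the squared distance to (p, q) by (2c)² shows that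
-- (2c(x − p))² + (c(z − 2q))² is a rational square for every rational c, and a rational
-- square never reduces to 2 modulo 3, since the squares in 𝔽₃ are 0 and 1. If x and z are
-- both 3-integral, take c = 1: for every residue of x and z and every nonzero residue of a,
-- one of the four sums of squares given by the points of R_a reduces to 2. If
-- v₃(x) = v₃(z) = −k < 0, take c = 3^k: then 3^k x and 3^k z are units, and the sum given
-- by (0, 1/2) reduces to 1 + 1.
module Submission where

open import Defs
open import Data.Integer as ℤ using (ℤ; +_; -[1+_])
open import Data.Rational using (ℚ; 0ℚ; ½; -_; _*_)
open import Data.Product using (Σ; _×_)
open import Data.Sum using (_⊎_)
open import Relation.Binary.PropositionalEquality using (_≢_)

open import Data.Empty using (⊥; ⊥-elim)
open import Data.Fin using (Fin; toℕ; fromℕ<)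
open import Data.Fin.Patterns using (0F; 1F; 2F)
open import Data.Fin.Properties using (all?; _≟_; toℕ-fromℕ<)
open import Data.Integer.Divisibility using (_∣_)
import Data.Integer.Divisibility.Signed as Signed
open import Data.Integer.DivMod using (_%ℕ_; _/ℕ_; n%ℕd<d; a≡a%ℕn+[a/ℕn]*n)
import Data.Integer.Properties as ℤP
import Data.Integer.Tactic.RingSolver as ℤ-Solver
open import Data.Maybe using (nothing)
open import Data.Nat as ℕ using (ℕ; zero; suc)
import Data.Nat.Coprimality as Coprimality
open import Data.Nat.Divisibility as ℕ using (_∣?_; divides)
open import Data.Nat.Induction using (<-wellFounded)
import Data.Nat.Properties as ℕP
import Data.Nat.Tactic.RingSolver as ℕ-Solver
open import Data.Product using (_,_; ∃)
open import Data.Rational using (1ℚ; _+_; _-_; ↥_; ↧_; ↧ₙ_; mkℚ; toℚᵘ)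
import Data.Rational.Properties as ℚP
open import Data.Rational.Unnormalised as ℚᵘ using (mkℚᵘ; *≡*) renaming (_≃_ to _≃ᵘ_)
import Data.Rational.Unnormalised.Properties as ℚᵘP
open import Data.Sum using (inj₁; inj₂; [_,_])
open import Function using (_$_)
open import Induction.WellFounded using (Acc; acc)
open import Relation.Binary.PropositionalEquality using (_≡_; refl; sym; trans; cong; cong₂; subst; module ≡-Reasoning)
open import Relation.Nullary using (¬_; yes; no; contradiction)
open import Relation.Nullary.Decidable using (from-yes; _→-dec_; ¬?; _⊎-dec_)
open import Tactic.RingSolver using (solve-∀)
open import Tactic.RingSolver.Core.AlmostCommutativeRing using (AlmostCommutativeRing; fromCommutativeRing)

𝔽₃ : Set
𝔽₃ = Fin 3

lift : 𝔽₃ → ℤ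
lift ρ = + toℕ ρ

reduce : ℤ → 𝔽₃
reduce i = fromℕ< (n%ℕd<d i 3)

infixl 6 _+₃_ _-₃_
infixl 7 _*₃_
infix 8 -₃_

_+₃_ _*₃_ : 𝔽₃ → 𝔽₃ → 𝔽₃
ρ +₃ σ = reduce (lift ρ ℤ.+ lift σ)
ρ *₃ σ = reduce (lift ρ ℤ.* lift σ)

-₃_ : 𝔽₃ → 𝔽₃
-₃ ρ = 2F *₃ ρ

_-₃_ : 𝔽₃ → 𝔽₃ → 𝔽₃
ρ -₃ σ = ρ +₃ -₃ σ

infix 4 _≡₃_
record _≡₃_ (i j : ℤ) : Set where
  constructor mod3
  field 3∣i-j : + 3 Signed.∣ i ℤ.- j

≡₃-sym : ∀ {i j} → i ≡₃ j → j ≡₃ i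
≡₃-sym {i} {j} (mod3 i≡j) = mod3 $ subst (+ 3 Signed.∣_) (identity i j) (Signed.∣m⇒∣-m i≡j)
  where
  identity : ∀ i j → ℤ.- (i ℤ.- j) ≡ j ℤ.- i
  identity = ℤ-Solver.solve-∀

≡₃-trans : ∀ {i j k} → i ≡₃ j → j ≡₃ k → i ≡₃ k
≡₃-trans {i} {j} {k} (mod3 i≡j) (mod3 j≡k) =
  mod3 $ subst (+ 3 Signed.∣_) (identity i j k) (Signed.∣m∣n⇒∣m+n i≡j j≡k)
  where
  identity : ∀ i j k → (i ℤ.- j) ℤ.+ (j ℤ.- k) ≡ i ℤ.- k
  identity = ℤ-Solver.solve-∀

≡₃-+ : ∀ {i i′ j j′} → i ≡₃ i′ → j ≡₃ j′ → i ℤ.+ j ≡₃ i′ ℤ.+ j′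
≡₃-+ {i} {i′} {j} {j′} (mod3 i≡) (mod3 j≡) =
  mod3 $ subst (+ 3 Signed.∣_) (identity i i′ j j′) (Signed.∣m∣n⇒∣m+n i≡ j≡)
  where
  identity : ∀ i i′ j j′ → (i ℤ.- i′) ℤ.+ (j ℤ.- j′) ≡ (i ℤ.+ j) ℤ.- (i′ ℤ.+ j′)
  identity = ℤ-Solver.solve-∀

≡₃-* : ∀ {i i′ j j′} → i ≡₃ i′ → j ≡₃ j′ → i ℤ.* j ≡₃ i′ ℤ.* j′
≡₃-* {i} {i′} {j} {j′} (mod3 i≡) (mod3 j≡) = mod3 $
  subst (+ 3 Signed.∣_) (identity i i′ j j′)
    (Signed.∣m∣n⇒∣m+n (Signed.∣m⇒∣m*n j i≡) (Signed.∣n⇒∣m*n i′ j≡))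
  where
  identity : ∀ i i′ j j′ → (i ℤ.- i′) ℤ.* j ℤ.+ i′ ℤ.* (j ℤ.- j′) ≡ i ℤ.* j ℤ.- i′ ℤ.* j′
  identity = ℤ-Solver.solve-∀

lift-reduce : ∀ i → i ≡₃ lift (reduce i)
lift-reduce i = mod3 $ Signed.divides (i /ℕ 3) (begin
  i ℤ.- lift (reduce i)                       ≡⟨ cong (λ r → i ℤ.- + r) (toℕ-fromℕ< (n%ℕd<d i 3)) ⟩
  i ℤ.- + (i %ℕ 3)                            ≡⟨ cong (ℤ._- + (i %ℕ 3)) (a≡a%ℕn+[a/ℕn]*n i 3) ⟩
  + (i %ℕ 3) ℤ.+ (i /ℕ 3) ℤ.* + 3 ℤ.- + (i %ℕ 3) ≡⟨ identity (+ (i %ℕ 3)) ((i /ℕ 3) ℤ.* + 3) ⟩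
  (i /ℕ 3) ℤ.* + 3                            ∎)
  where
  open ≡-Reasoning
  identity : ∀ r m → r ℤ.+ m ℤ.- r ≡ m
  identity = ℤ-Solver.solve-∀

lift-injective : ∀ ρ σ → lift ρ ≡₃ lift σ → ρ ≡ σ
lift-injective ρ σ (mod3 3∣ρ-σ) =
  from-yes (all? λ ρ → all? λ σ → (+ 3 Signed.∣? lift ρ ℤ.- lift σ) →-dec ρ ≟ σ) ρ σ 3∣ρ-σ

reduce-cong : ∀ {i j} → i ≡₃ j → reduce i ≡ reduce j
reduce-cong {i} {j} i≡j =
  lift-injective _ _ (≡₃-trans (≡₃-sym (lift-reduce i)) (≡₃-trans i≡j (lift-reduce j)))

reduce-+ : ∀ i j → reduce (i ℤ.+ j) ≡ reduce i +₃ reduce j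
reduce-+ i j = reduce-cong (≡₃-+ (lift-reduce i) (lift-reduce j))

reduce-* : ∀ i j → reduce (i ℤ.* j) ≡ reduce i *₃ reduce j
reduce-* i j = reduce-cong (≡₃-* (lift-reduce i) (lift-reduce j))

reduce≡0⇒3∣ : ∀ i → reduce i ≡ 0F → + 3 ∣ i
reduce≡0⇒3∣ i i↦0 with subst (λ ρ → i ≡₃ lift ρ) i↦0 (lift-reduce i)
... | mod3 3∣i-0 = Signed.∣⇒∣ᵤ (subst (+ 3 Signed.∣_) (ℤP.+-identityʳ i) 3∣i-0)

ℚ-ring : AlmostCommutativeRing _ _
ℚ-ring = fromCommutativeRing ℚP.+-*-commutativeRing (λ _ → nothing)

toℚᵘ-ι : ∀ i → toℚᵘ (ι i) ≃ᵘ mkℚᵘ i 0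
toℚᵘ-ι i = ℚP.toℚᵘ-fromℚᵘ (mkℚᵘ i 0)

ι-+ : ∀ i j → ι (i ℤ.+ j) ≡ ι i + ι j
ι-+ i j = ℚP.toℚᵘ-injective (begin
  toℚᵘ (ι (i ℤ.+ j))          ≈⟨ toℚᵘ-ι (i ℤ.+ j) ⟩
  mkℚᵘ (i ℤ.+ j) 0
    ≈⟨ *≡* (cong (ℤ._* + 1) (sym (cong₂ ℤ._+_ (ℤP.*-identityʳ i) (ℤP.*-identityʳ j)))) ⟩
  mkℚᵘ i 0 ℚᵘ.+ mkℚᵘ j 0      ≈⟨ ℚᵘP.+-cong (toℚᵘ-ι i) (toℚᵘ-ι j) ⟨
  toℚᵘ (ι i) ℚᵘ.+ toℚᵘ (ι j)  ≈⟨ ℚP.toℚᵘ-homo-+ (ι i) (ι j) ⟨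
  toℚᵘ (ι i + ι j)            ∎)
  where open ℚᵘP.≃-Reasoning

ι-* : ∀ i j → ι (i ℤ.* j) ≡ ι i * ι j
ι-* i j = ℚP.toℚᵘ-injective (begin
  toℚᵘ (ι (i ℤ.* j))          ≈⟨ toℚᵘ-ι (i ℤ.* j) ⟩
  mkℚᵘ (i ℤ.* j) 0            ≈⟨ *≡* refl ⟩
  mkℚᵘ i 0 ℚᵘ.* mkℚᵘ j 0      ≈⟨ ℚᵘP.*-cong (toℚᵘ-ι i) (toℚᵘ-ι j) ⟨
  toℚᵘ (ι i) ℚᵘ.* toℚᵘ (ι j)  ≈⟨ ℚP.toℚᵘ-homo-* (ι i) (ι j) ⟨
  toℚᵘ (ι i * ι j)            ∎)
  where open ℚᵘP.≃-Reasoning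

ι-injective : ∀ {i j} → ι i ≡ ι j → i ≡ j
ι-injective {i} {j} ιi≡ιj
  with ℚᵘP.≃-trans (ℚᵘP.≃-sym (toℚᵘ-ι i)) (ℚᵘP.≃-trans (ℚP.toℚᵘ-cong ιi≡ιj) (toℚᵘ-ι j))
... | *≡* eq = trans (sym (ℤP.*-identityʳ i)) (trans eq (ℤP.*-identityʳ j))

p*↧p≡↥p : ∀ p → p * ι (↧ p) ≡ ι (↥ p)
p*↧p≡↥p p@(mkℚ n d-1 _) = ℚP.toℚᵘ-injective (begin
  toℚᵘ (p * ι (+ suc d-1))                ≈⟨ ℚP.toℚᵘ-homo-* p (ι (+ suc d-1)) ⟩
  toℚᵘ p ℚᵘ.* toℚᵘ (ι (+ suc d-1))        ≈⟨ ℚᵘP.*-congˡ {toℚᵘ p} (toℚᵘ-ι (+ suc d-1)) ⟩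
  mkℚᵘ n d-1 ℚᵘ.* mkℚᵘ (+ suc d-1) 0     ≈⟨ *≡* eq ⟩
  mkℚᵘ n 0                               ≈⟨ toℚᵘ-ι n ⟨
  toℚᵘ (ι n)                             ∎)
  where
  open ℚᵘP.≃-Reasoning
  eq : (n ℤ.* + suc d-1) ℤ.* + 1 ≡ n ℤ.* + suc (d-1 ℕ.* 1)
  eq = trans (ℤP.*-identityʳ _) (cong (λ d → n ℤ.* + suc d) (sym (ℕP.*-identityʳ d-1)))

*₃-identityʳ : ∀ ρ → ρ *₃ 1F ≡ ρ
*₃-identityʳ = from-yes (all? λ ρ → ρ *₃ 1F ≟ ρ)

*₃-nonzero : ∀ ρ σ → ρ ≢ 0F → σ ≢ 0F → ρ *₃ σ ≢ 0F
*₃-nonzero = from-yes (all? λ ρ → all? λ σ → ¬? (ρ ≟ 0F) →-dec ¬? (σ ≟ 0F) →-dec ¬? (ρ *₃ σ ≟ 0F))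

cross-sum : ∀ r s e f → r *₃ e *₃ f +₃ s *₃ f *₃ e ≡ (r +₃ s) *₃ (e *₃ f)
cross-sum = from-yes (all? λ r → all? λ s → all? λ e → all? λ f →
  r *₃ e *₃ f +₃ s *₃ f *₃ e ≟ (r +₃ s) *₃ (e *₃ f))

cross-product : ∀ r s e f → r *₃ e *₃ (s *₃ f) ≡ r *₃ s *₃ (e *₃ f)
cross-product = from-yes (all? λ r → all? λ s → all? λ e → all? λ f →
  r *₃ e *₃ (s *₃ f) ≟ r *₃ s *₃ (e *₃ f))

unit-square : ∀ ρ e → e ≢ 0F → ρ *₃ e *₃ e ≡ ρ
unit-square = from-yes (all? λ ρ → all? λ e → ¬? (e ≟ 0F) →-dec ρ *₃ e *₃ e ≟ ρ)

unit-cancel : ∀ r s e f → e ≢ 0F → f ≢ 0F → r *₃ e *₃ f ≡ s *₃ f *₃ e → r ≡ s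
unit-cancel = from-yes (all? λ r → all? λ s → all? λ e → all? λ f →
  ¬? (e ≟ 0F) →-dec ¬? (f ≟ 0F) →-dec r *₃ e *₃ f ≟ s *₃ f *₃ e →-dec r ≟ s)

-- q lies in ℤ₍₃₎ (it is num/den with 3 ∤ den) and its image in 𝔽₃ is r.
record Reduces (q : ℚ) (r : 𝔽₃) : Set where
  constructor reduces
  field
    num den   : ℤ
    den≢0     : reduce den ≢ 0F
    q*den≡num : q * ι den ≡ ι num
    num≡r*den : reduce num ≡ r *₃ reduce den

reduce-*-≢0 : ∀ e f → reduce e ≢ 0F → reduce f ≢ 0F → reduce (e ℤ.* f) ≢ 0F
reduce-*-≢0 e f e≢0 f≢0 = subst (_≢ 0F) (sym (reduce-* e f)) (*₃-nonzero _ _ e≢0 f≢0)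

Reduces-ι : ∀ n → Reduces (ι n) (reduce n)
Reduces-ι n = reduces n (+ 1) (λ ()) (ℚP.*-identityʳ (ι n)) (sym (*₃-identityʳ (reduce n)))

Reduces-fraction : ∀ {q} n e → reduce e ≢ 0F → q * ι e ≡ ι n → Reduces q (reduce n *₃ reduce e)
Reduces-fraction n e e≢0 q*e≡n = reduces n e e≢0 q*e≡n (sym (unit-square (reduce n) (reduce e) e≢0))

Reduces-+ : ∀ {p q r s} → Reduces p r → Reduces q s → Reduces (p + q) (r +₃ s)
Reduces-+ {p} {q} {r} {s} (reduces n₁ e₁ e₁≢0 p≡ n₁≡) (reduces n₂ e₂ e₂≢0 q≡ n₂≡) =
  reduces (n₁ ℤ.* e₂ ℤ.+ n₂ ℤ.* e₁) (e₁ ℤ.* e₂) (reduce-*-≢0 e₁ e₂ e₁≢0 e₂≢0) in-ℚ in-𝔽₃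
  where
  open ≡-Reasoning
  identity : ∀ p q a b → (p + q) * (a * b) ≡ p * a * b + q * b * a
  identity = solve-∀ ℚ-ring
  in-ℚ : (p + q) * ι (e₁ ℤ.* e₂) ≡ ι (n₁ ℤ.* e₂ ℤ.+ n₂ ℤ.* e₁)
  in-ℚ = begin
    (p + q) * ι (e₁ ℤ.* e₂)                ≡⟨ cong ((p + q) *_) (ι-* e₁ e₂) ⟩
    (p + q) * (ι e₁ * ι e₂)                ≡⟨ identity p q (ι e₁) (ι e₂) ⟩
    p * ι e₁ * ι e₂ + q * ι e₂ * ι e₁      ≡⟨ cong₂ (λ u v → u * ι e₂ + v * ι e₁) p≡ q≡ ⟩
    ι n₁ * ι e₂ + ι n₂ * ι e₁              ≡⟨ cong₂ _+_ (ι-* n₁ e₂) (ι-* n₂ e₁) ⟨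
    ι (n₁ ℤ.* e₂) + ι (n₂ ℤ.* e₁)          ≡⟨ ι-+ (n₁ ℤ.* e₂) (n₂ ℤ.* e₁) ⟨
    ι (n₁ ℤ.* e₂ ℤ.+ n₂ ℤ.* e₁)            ∎
  in-𝔽₃ : reduce (n₁ ℤ.* e₂ ℤ.+ n₂ ℤ.* e₁) ≡ (r +₃ s) *₃ reduce (e₁ ℤ.* e₂)
  in-𝔽₃ = begin
    reduce (n₁ ℤ.* e₂ ℤ.+ n₂ ℤ.* e₁)
      ≡⟨ reduce-+ (n₁ ℤ.* e₂) (n₂ ℤ.* e₁) ⟩
    reduce (n₁ ℤ.* e₂) +₃ reduce (n₂ ℤ.* e₁)
      ≡⟨ cong₂ _+₃_ (reduce-* n₁ e₂) (reduce-* n₂ e₁) ⟩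
    reduce n₁ *₃ reduce e₂ +₃ reduce n₂ *₃ reduce e₁
      ≡⟨ cong₂ (λ u v → u *₃ reduce e₂ +₃ v *₃ reduce e₁) n₁≡ n₂≡ ⟩
    r *₃ reduce e₁ *₃ reduce e₂ +₃ s *₃ reduce e₂ *₃ reduce e₁
      ≡⟨ cross-sum r s (reduce e₁) (reduce e₂) ⟩
    (r +₃ s) *₃ (reduce e₁ *₃ reduce e₂)
      ≡⟨ cong ((r +₃ s) *₃_) (reduce-* e₁ e₂) ⟨
    (r +₃ s) *₃ reduce (e₁ ℤ.* e₂)
      ∎

Reduces-* : ∀ {p q r s} → Reduces p r → Reduces q s → Reduces (p * q) (r *₃ s)
Reduces-* {p} {q} {r} {s} (reduces n₁ e₁ e₁≢0 p≡ n₁≡) (reduces n₂ e₂ e₂≢0 q≡ n₂≡) =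
  reduces (n₁ ℤ.* n₂) (e₁ ℤ.* e₂) (reduce-*-≢0 e₁ e₂ e₁≢0 e₂≢0) in-ℚ in-𝔽₃
  where
  open ≡-Reasoning
  identity : ∀ p q a b → (p * q) * (a * b) ≡ (p * a) * (q * b)
  identity = solve-∀ ℚ-ring
  in-ℚ : p * q * ι (e₁ ℤ.* e₂) ≡ ι (n₁ ℤ.* n₂)
  in-ℚ = begin
    p * q * ι (e₁ ℤ.* e₂)        ≡⟨ cong (p * q *_) (ι-* e₁ e₂) ⟩
    p * q * (ι e₁ * ι e₂)        ≡⟨ identity p q (ι e₁) (ι e₂) ⟩
    (p * ι e₁) * (q * ι e₂)      ≡⟨ cong₂ _*_ p≡ q≡ ⟩
    ι n₁ * ι n₂                  ≡⟨ ι-* n₁ n₂ ⟨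
    ι (n₁ ℤ.* n₂)                ∎
  in-𝔽₃ : reduce (n₁ ℤ.* n₂) ≡ r *₃ s *₃ reduce (e₁ ℤ.* e₂)
  in-𝔽₃ = begin
    reduce (n₁ ℤ.* n₂)                            ≡⟨ reduce-* n₁ n₂ ⟩
    reduce n₁ *₃ reduce n₂                        ≡⟨ cong₂ _*₃_ n₁≡ n₂≡ ⟩
    r *₃ reduce e₁ *₃ (s *₃ reduce e₂)            ≡⟨ cross-product r s (reduce e₁) (reduce e₂) ⟩
    r *₃ s *₃ (reduce e₁ *₃ reduce e₂)            ≡⟨ cong (r *₃ s *₃_) (reduce-* e₁ e₂) ⟨
    r *₃ s *₃ reduce (e₁ ℤ.* e₂)                  ∎

Reduces-neg : ∀ {q r} → Reduces q r → Reduces (- q) (-₃ r)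
Reduces-neg {q} q↦r = subst (λ t → Reduces t _) (-1*q≡-q q) (Reduces-* (Reduces-ι -[1+ 0 ]) q↦r)
  where
  -1*q≡-q : ∀ q → ι -[1+ 0 ] * q ≡ - q
  -1*q≡-q = solve-∀ ℚ-ring

Reduces-- : ∀ {p q r s} → Reduces p r → Reduces q s → Reduces (p - q) (r -₃ s)
Reduces-- p↦r q↦s = Reduces-+ p↦r (Reduces-neg q↦s)

Reduces-unique : ∀ {q r s} → Reduces q r → Reduces q s → r ≡ s
Reduces-unique {q} {r} {s} (reduces n e e≢0 q≡ n≡) (reduces n′ e′ e′≢0 q≡′ n′≡) =
  unit-cancel r s (reduce e) (reduce e′) e≢0 e′≢0 (begin
    r *₃ reduce e *₃ reduce e′    ≡⟨ cong (_*₃ reduce e′) n≡ ⟨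
    reduce n *₃ reduce e′         ≡⟨ reduce-* n e′ ⟨
    reduce (n ℤ.* e′)             ≡⟨ cong reduce cross ⟩
    reduce (n′ ℤ.* e)             ≡⟨ reduce-* n′ e ⟩
    reduce n′ *₃ reduce e         ≡⟨ cong (_*₃ reduce e) n′≡ ⟩
    s *₃ reduce e′ *₃ reduce e    ∎)
  where
  open ≡-Reasoning
  identity : ∀ q a b → q * a * b ≡ q * b * a
  identity = solve-∀ ℚ-ring
  cross : n ℤ.* e′ ≡ n′ ℤ.* e
  cross = ι-injective (begin
    ι (n ℤ.* e′)        ≡⟨ ι-* n e′ ⟩
    ι n * ι e′          ≡⟨ cong (_* ι e′) q≡ ⟨
    q * ι e * ι e′      ≡⟨ identity q (ι e) (ι e′) ⟩
    q * ι e′ * ι e      ≡⟨ cong (_* ι e) q≡′ ⟩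
    ι n′ * ι e          ≡⟨ ι-* n′ e ⟨
    ι (n′ ℤ.* e)        ∎)

factor-out : ∀ {p} → 1 ℕ.< p → ∀ n → n ≢ 0 → Σ ℕ λ k → Σ ℕ λ s → n ≡ s ℕ.* p ℕ.^ k × ¬ p ℕ.∣ s
factor-out {p} 1<p n n≢0 = go n n≢0 (<-wellFounded n)
  where
  go : ∀ n → n ≢ 0 → Acc ℕ._<_ n → Σ ℕ λ k → Σ ℕ λ s → n ≡ s ℕ.* p ℕ.^ k × ¬ p ℕ.∣ s
  go n n≢0 (acc rec) with p ∣? n
  ... | no p∤n = 0 , n , sym (ℕP.*-identityʳ n) , p∤n
  ... | yes (divides q refl) with go q q≢0 (rec (ℕP.m<m*n q p 1<p))
    where
    q≢0 : q ≢ 0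
    q≢0 refl = n≢0 refl
    instance _ = ℕ.≢-nonZero q≢0
  ...   | k , s , refl , p∤s = suc k , s , identity s (p ℕ.^ k) p , p∤s
    where
    identity : ∀ s a p → s ℕ.* a ℕ.* p ≡ s ℕ.* (p ℕ.* a)
    identity = ℕ-Solver.solve-∀

pos-^ : ∀ m k → + (m ℕ.^ k) ≡ (+ m) ℤ.^ k
pos-^ m zero    = refl
pos-^ m (suc k) = trans (ℤP.pos-* m (m ℕ.^ k)) (cong (+ m ℤ.*_) (pos-^ m k))

3∤⇒reduce≢0 : ∀ i → ¬ + 3 ∣ i → reduce i ≢ 0F
3∤⇒reduce≢0 i 3∤i i↦0 = 3∤i (reduce≡0⇒3∣ i i↦0)

3^_ : ℕ → ℚ
3^ k = ι ((+ 3) ℤ.^ k)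

Reduces-3^suc : ∀ m → Reduces (3^ suc m) 0F
Reduces-3^suc m =
  subst (Reduces (3^ suc m)) (reduce-* (+ 3) ((+ 3) ℤ.^ m)) (Reduces-ι ((+ 3) ℤ.^ suc m))

Val∞⇒Reduces : ∀ {t} → Val 3 t ∞ → Reduces t 0F
Val∞⇒Reduces val-zero = Reduces-ι (+ 0)

Val⁺⇒Reduces : ∀ {t m} → Val 3 t (fin (+ m)) → ∃ (Reduces t)
Val⁺⇒Reduces {t} {m} (val-fin _ (r , s , _ , 3∤s , eq)) =
  _ , Reduces-fraction ((+ 3) ℤ.^ m ℤ.* r) s (3∤⇒reduce≢0 s 3∤s)
        (trans (sym (ℚP.*-identityʳ (t * ι s))) eq)

scaled-unit : ∀ {t c} r s → ¬ + 3 ∣ r → ¬ + 3 ∣ s → t * ι s * ι c ≡ ι (+ 1 ℤ.* r) →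
              Σ 𝔽₃ λ U → U ≢ 0F × Reduces (t * ι c) U
scaled-unit {t} {c} r s 3∤r 3∤s eq =
  _ , *₃-nonzero _ _ (3∤⇒reduce≢0 r 3∤r) (3∤⇒reduce≢0 s 3∤s) ,
  Reduces-fraction r s (3∤⇒reduce≢0 s 3∤s) (begin
    t * ι c * ι s    ≡⟨ identity t (ι c) (ι s) ⟩
    t * ι s * ι c    ≡⟨ eq ⟩
    ι (+ 1 ℤ.* r)    ≡⟨ cong ι (ℤP.*-identityˡ r) ⟩
    ι r              ∎)
  where
  open ≡-Reasoning
  identity : ∀ t a b → t * a * b ≡ t * b * a
  identity = solve-∀ ℚ-ring

Val⁰⇒unit : ∀ {t} → Val 3 t (fin (+ 0)) → Σ 𝔽₃ λ U → U ≢ 0F × Reduces t U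
Val⁰⇒unit {t} (val-fin _ (r , s , 3∤r , 3∤s , eq)) with scaled-unit {t} {+ 1} r s 3∤r 3∤s eq
... | U , U≢0 , t↦U = U , U≢0 , subst (λ q → Reduces q U) (ℚP.*-identityʳ t) t↦U

Val⁻⇒unit : ∀ {t m} → Val 3 t (fin -[1+ m ]) → Σ 𝔽₃ λ U → U ≢ 0F × Reduces (t * 3^ suc m) U
Val⁻⇒unit {t} {m} (val-fin _ (r , s , 3∤r , 3∤s , eq)) = scaled-unit {t} {(+ 3) ℤ.^ suc m} r s 3∤r 3∤s eq

Reduces⊎Val<0 : ∀ q → ∃ (Reduces q) ⊎ Σ ℤ λ k → Val 3 q (fin k) × k ℤ.< + 0
Reduces⊎Val<0 q@(mkℚ _ _ coprime) with reduce (↧ q) ≟ 0F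
... | no ↧≢0 = inj₁ (_ , Reduces-fraction (↥ q) (↧ q) ↧≢0 (p*↧p≡↥p q))
... | yes ↧↦0 with factor-out (ℕ.s≤s (ℕ.s≤s ℕ.z≤n)) (↧ₙ q) (λ ())
...   | zero  , s , ↧≡s , 3∤s =
  contradiction (subst (3 ℕ.∣_) (trans ↧≡s (ℕP.*-identityʳ s)) (reduce≡0⇒3∣ (↧ q) ↧↦0)) 3∤s
...   | suc m , s , ↧≡ , 3∤s = inj₂ (-[1+ m ] , val-fin q≢0 (↥ q , + s , 3∤↥q , 3∤s , eq) , ℤ.-<+)
  where
  open ≡-Reasoning
  q≢0 : q ≢ 0ℚ
  q≢0 q≡0 = contradiction (subst (λ p → reduce (↧ p) ≡ 0F) q≡0 ↧↦0) λ ()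
  3∤↥q : ¬ + 3 ∣ ↥ q
  3∤↥q 3∣↥q = contradiction (Coprimality.recompute coprime (3∣↥q , reduce≡0⇒3∣ (↧ q) ↧↦0)) λ ()
  eq : q * ι (+ s) * 3^ suc m ≡ ι ((+ 3) ℤ.^ 0 ℤ.* ↥ q)
  eq = begin
    q * ι (+ s) * 3^ suc m                ≡⟨ ℚP.*-assoc q (ι (+ s)) (3^ suc m) ⟩
    q * (ι (+ s) * 3^ suc m)              ≡⟨ cong (q *_) (ι-* (+ s) ((+ 3) ℤ.^ suc m)) ⟨
    q * ι (+ s ℤ.* (+ 3) ℤ.^ suc m)       ≡⟨ cong (λ d → q * ι (+ s ℤ.* d)) (pos-^ 3 (suc m)) ⟨
    q * ι (+ s ℤ.* + (3 ℕ.^ suc m))       ≡⟨ cong (λ d → q * ι d) (trans (cong +_ ↧≡) (ℤP.pos-* s (3 ℕ.^ suc m))) ⟨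
    q * ι (↧ q)                           ≡⟨ p*↧p≡↥p q ⟩
    ι (↥ q)                               ≡⟨ cong ι (ℤP.*-identityˡ (↥ q)) ⟨
    ι ((+ 3) ℤ.^ 0 ℤ.* ↥ q)               ∎

square≢2 : ∀ ρ → ρ *₃ ρ ≢ 2F
square≢2 = from-yes (all? λ ρ → ¬? (ρ *₃ ρ ≟ 2F))

square-residue≢2 : ∀ w {D r} → w * w ≡ D → Reduces D r → r ≢ 2F
square-residue≢2 w {D} w²≡D D↦r with Reduces⊎Val<0 w
... | inj₁ (ρ , w↦ρ) = λ r≡2 →
  square≢2 ρ (trans (Reduces-unique (subst (λ q → Reduces q (ρ *₃ ρ)) w²≡D (Reduces-* w↦ρ w↦ρ)) D↦r) r≡2)
... | inj₂ (+ _ , _ , ℤ.+<+ ())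
-- w · 3^(m+1) reduces to a unit U, while its square 3^(2m+2) · D reduces to 0.
... | inj₂ (-[1+ m ] , w-val , _) with Val⁻⇒unit w-val
...   | U , U≢0 , wc↦U = λ _ → *₃-nonzero U U U≢0 U≢0 (Reduces-unique (Reduces-* wc↦U wc↦U)
          (subst (λ q → Reduces q 0F) (sym scaled) (Reduces-* (Reduces-* c↦0 c↦0) D↦r)))
  where
  c = 3^ suc m
  c↦0 = Reduces-3^suc m
  identity : ∀ w c → w * c * (w * c) ≡ c * c * (w * w)
  identity = solve-∀ ℚ-ring
  scaled : w * c * (w * c) ≡ c * c * D
  scaled = trans (identity w c) (cong (c * c *_) w²≡D)

sum-of-squares-residue≢2 : ∀ {u v U V} → Σ ℚ (λ w → w * w ≡ u * u + v * v) →
                           Reduces u U → Reduces v V → U *₃ U +₃ V *₃ V ≢ 2F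
sum-of-squares-residue≢2 (w , w²≡) u↦U v↦V =
  square-residue≢2 w w²≡ (Reduces-+ (Reduces-* u↦U u↦U) (Reduces-* v↦V v↦V))

scaled-distance : ∀ x z p q → RationalDist x (z * ½) p q → ∀ c →
  Σ ℚ λ w → w * w ≡ ι (+ 2) * (x * c - p * c) * (ι (+ 2) * (x * c - p * c))
                    + (z * c - ι (+ 2) * q * c) * (z * c - ι (+ 2) * q * c)
scaled-distance x z p q (d , _ , d²≡) c = ι (+ 2) * d * c , (begin
  ι (+ 2) * d * c * (ι (+ 2) * d * c)
    ≡⟨ factor d c ⟩
  ι (+ 2) * ι (+ 2) * (c * c) * (d * d)
    ≡⟨ cong (ι (+ 2) * ι (+ 2) * (c * c) *_) d²≡ ⟩
  ι (+ 2) * ι (+ 2) * (c * c) * ((x - p) * (x - p) + (z * ½ - q) * (z * ½ - q))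
    ≡⟨ expand x z p q c ⟩
  ι (+ 2) * (x * c - p * c) * (ι (+ 2) * (x * c - p * c))
    + (z * c - ι (+ 2) * q * c) * (z * c - ι (+ 2) * q * c) ∎)
  where
  open ≡-Reasoning
  factor : ∀ d c → ι (+ 2) * d * c * (ι (+ 2) * d * c) ≡ ι (+ 2) * ι (+ 2) * (c * c) * (d * d)
  factor = solve-∀ ℚ-ring
  expand : ∀ x z p q c →
    ι (+ 2) * ι (+ 2) * (c * c) * ((x - p) * (x - p) + (z * ½ - q) * (z * ½ - q))
    ≡ ι (+ 2) * (x * c - p * c) * (ι (+ 2) * (x * c - p * c))
      + (z * c - ι (+ 2) * q * c) * (z * c - ι (+ 2) * q * c)
  expand = solve-∀ ℚ-ring

distance-residue : (X Z C P Q : 𝔽₃) → 𝔽₃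
distance-residue X Z C P Q = U *₃ U +₃ V *₃ V
  where
  U = 2F *₃ (X -₃ P *₃ C)
  V = Z -₃ Q *₃ C

distance-residue≢2 : ∀ x z p q c {X Z C P Q} → RationalDist x (z * ½) p q →
  Reduces (x * c) X → Reduces (z * c) Z → Reduces c C → Reduces p P → Reduces (ι (+ 2) * q) Q →
  distance-residue X Z C P Q ≢ 2F
distance-residue≢2 x z p q c dist x↦X z↦Z c↦C p↦P q↦Q =
  sum-of-squares-residue≢2 (scaled-distance x z p q dist c)
    (Reduces-* (Reduces-ι (+ 2)) (Reduces-- x↦X (Reduces-* p↦P c↦C))) (Reduces-- z↦Z (Reduces-* q↦Q c↦C))

integral-point-residues : ∀ A X Z → A ≢ 0F →
  distance-residue X Z 1F 0F 1F ≡ 2F ⊎ distance-residue X Z 1F 0F 2F ≡ 2F ⊎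
  distance-residue X Z 1F A 1F ≡ 2F ⊎ distance-residue X Z 1F A 2F ≡ 2F
integral-point-residues = from-yes (all? λ A → all? λ X → all? λ Z → ¬? (A ≟ 0F) →-dec
  (distance-residue X Z 1F 0F 1F ≟ 2F ⊎-dec distance-residue X Z 1F 0F 2F ≟ 2F ⊎-dec
   distance-residue X Z 1F A 1F ≟ 2F ⊎-dec distance-residue X Z 1F A 2F ≟ 2F))

unit-point-residue : ∀ X Z → X ≢ 0F → Z ≢ 0F → distance-residue X Z 0F 0F 1F ≡ 2F
unit-point-residue = from-yes (all? λ X → all? λ Z → ¬? (X ≟ 0F) →-dec ¬? (Z ≟ 0F) →-dec
  distance-residue X Z 0F 0F 1F ≟ 2F)

-- 2 * ½ and 2 * (- ½) evaluate to the integers 1 and -1.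
2*½↦1 : Reduces (ι (+ 2) * ½) 1F
2*½↦1 = Reduces-ι (+ 1)

2*-½↦2 : Reduces (ι (+ 2) * - ½) 2F
2*-½↦2 = Reduces-ι -[1+ 0 ]

no-integral-point : ∀ {a x z A X Z} → A ≢ 0F → Reduces a A → Reduces x X → Reduces z Z →
  RationalDist x (z * ½) 0ℚ ½ → RationalDist x (z * ½) 0ℚ (- ½) →
  RationalDist x (z * ½) a ½ → RationalDist x (z * ½) a (- ½) → ⊥
no-integral-point {a} {x} {z} {A} {X} {Z} A≢0 a↦A x↦X z↦Z d₁ d₂ d₃ d₄ =
  [ residue≢2 0ℚ ½ d₁ 0↦0 2*½↦1 , [ residue≢2 0ℚ (- ½) d₂ 0↦0 2*-½↦2 ,
  [ residue≢2 a ½ d₃ a↦A 2*½↦1 , residue≢2 a (- ½) d₄ a↦A 2*-½↦2 ] ] ]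
    (integral-point-residues A X Z A≢0)
  where
  0↦0 : Reduces 0ℚ 0F
  0↦0 = Reduces-ι (+ 0)
  residue≢2 : ∀ {P Q} p q → RationalDist x (z * ½) p q → Reduces p P → Reduces (ι (+ 2) * q) Q →
              distance-residue X Z 1F P Q ≢ 2F
  residue≢2 p q dist = distance-residue≢2 x z p q 1ℚ dist
    (subst (λ t → Reduces t X) (sym (ℚP.*-identityʳ x)) x↦X)
    (subst (λ t → Reduces t Z) (sym (ℚP.*-identityʳ z)) z↦Z) (Reduces-ι (+ 1))

no-point-of-equal-negative-valuation : ∀ {x z} m → Val 3 x (fin -[1+ m ]) → Val 3 z (fin -[1+ m ]) →
  RationalDist x (z * ½) 0ℚ ½ → ⊥
no-point-of-equal-negative-valuation {x} {z} m x-val z-val d₁ with Val⁻⇒unit x-val | Val⁻⇒unit z-val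
... | X , X≢0 , xc↦X | Z , Z≢0 , zc↦Z =
  distance-residue≢2 x z 0ℚ ½ (3^ suc m) d₁ xc↦X zc↦Z (Reduces-3^suc m) (Reduces-ι (+ 0)) 2*½↦1
    (unit-point-residue X Z X≢0 Z≢0)

theorem2p3 : (a x z : ℚ) → Val 3 a (fin (+ 0)) →
    RationalDist x (z * ½) 0ℚ ½ →
    RationalDist x (z * ½) 0ℚ (- ½) →
    RationalDist x (z * ½) a ½ →
    RationalDist x (z * ½) a (- ½) →
    ((Σ ℤ λ k → Val 3 x (fin k) × k ℤ.< + 0) ⊎ (Σ ℤ λ k → Val 3 z (fin k) × k ℤ.< + 0))
    × (∀ u w → Val 3 x u → Val 3 z w → u ≢ w)
theorem2p3 a x z a-val d₁ d₂ d₃ d₄ = some-negative (Reduces⊎Val<0 x) (Reduces⊎Val<0 z) , valuations-differ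
  where
  not-both-integral : ∃ (Reduces x) → ∃ (Reduces z) → ⊥
  not-both-integral (_ , x↦X) (_ , z↦Z) with Val⁰⇒unit a-val
  ... | _ , A≢0 , a↦A = no-integral-point A≢0 a↦A x↦X z↦Z d₁ d₂ d₃ d₄

  some-negative : ∀ {Nx Nz} → ∃ (Reduces x) ⊎ Nx → ∃ (Reduces z) ⊎ Nz → Nx ⊎ Nz
  some-negative (inj₂ x<0)  _            = inj₁ x<0
  some-negative (inj₁ _)    (inj₂ z<0)   = inj₂ z<0
  some-negative (inj₁ x↦X) (inj₁ z↦Z)  = ⊥-elim (not-both-integral x↦X z↦Z)

  equal-valuations : ∀ {u} → Val 3 x u → Val 3 z u → ⊥
  equal-valuations {∞}             x-val z-val =
    not-both-integral (_ , Val∞⇒Reduces x-val) (_ , Val∞⇒Reduces z-val)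
  equal-valuations {fin (+ _)}     x-val z-val =
    not-both-integral (Val⁺⇒Reduces x-val) (Val⁺⇒Reduces z-val)
  equal-valuations {fin -[1+ m ]} x-val z-val =
    no-point-of-equal-negative-valuation m x-val z-val d₁

  valuations-differ : ∀ u w → Val 3 x u → Val 3 z w → u ≢ w
  valuations-differ u .u x-val z-val refl = equal-valuations x-val z-val
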